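{- Let $k, l, t$ be non-negative integers and let $G$ be a cubic graph. If $G$ has a $k$-core which has an $l$-cycle cover $\mathcal{C}_c$ of length $t$, then $G$ has an $(l+2)$-cycle cover $\mathcal{C}$ of length at most $\frac{4}{3}(|E(G)| - k) + t$. Furthermore, if $\mathcal{C}_c$ is even, then $\mathcal{C}$ is even.
   Context: Graphs are finite, may have parallel edges, but no loops. A 1-factor is a spanning 1-regular subgraph, identified with its edge set. For $X\subseteq E(G)$, $G[X]$ is the graph with edge set $X$ and vertex set all endpoints of edges of $X$. For three pairwise different 1-factors $M_1,M_2,M_3$ of a cubic graph $G$, let $\mathcal{M} = \bigcup_{i\neq j}(M_i\cap M_j)$ and $\mathcal{U} = E(G) - (M_1\cup M_2\cup M_3)$; if $|\mathcal{U}|=k$, then $G[\mathcal{M}\cup\mathcal{U}]$ is the $k$-core of $G$ with respect to $M_1,M_2,M_3$. A cycle is a graph (subgraph) all of whose vertices have even degree (an Eulerian graph); a circuit is a connected 2-regular graph, and a cycle in a graph of maximum degree 3 is a disjoint union of circuits. A cycle is even if all its circuits have even length. A cycle cover of a graph $H$ is a set of cycles of $H$ such that every edge of $H$ lies in at least one of them; an $l$-cycle cover consists of at most $l$ cycles; its length is the total number of edges of its cycles, $\sum_{C}|E(C)|$. A cycle cover is even if all its cycles are even. -}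

module Defs where

open import Data.Nat using (ℕ; _+_; _*_; _∸_; _≤_)
open import Data.Nat.Divisibility using (_∣_)
open import Data.Bool using (Bool; true; false; _∨_)
open import Data.Fin using (Fin; _≟_)
open import Data.Fin.Subset using (Subset; _∈_; _⊆_; _∩_; _∪_; ∣_∣; ⊤; ∁)
open import Data.Vec using (tabulate)
open import Data.List using (List; length; map)
open import Data.Nat.ListAction using (sum)
open import Data.List.Relation.Unary.All using (All)
open import Data.List.Relation.Unary.Any using (Any)
open import Data.Product using (_×_; proj₁; proj₂; Σ; ∃; ∃-syntax)
open import Relation.Binary.PropositionalEquality using (_≡_; _≢_)
open import Relation.Nullary using (¬_; does)
open import Function.Bundles using (_⇔_)

-- A finite multigraph without loops: vertices Fin n, edges Fin m,
-- each edge has two (distinct) endpoints.  Parallel edges are allowed.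
record Graph : Set where
  field
    n    : ℕ
    m    : ℕ
    ends : Fin m → Fin n × Fin n
    noLoop : ∀ e → proj₁ (ends e) ≢ proj₂ (ends e)
open Graph public

EdgeSet : Graph → Set
EdgeSet G = Subset (m G)

incident : (G : Graph) → Fin (m G) → Fin (n G) → Bool
incident G e v = does (proj₁ (ends G e) ≟ v) ∨ does (proj₂ (ends G e) ≟ v)

star : (G : Graph) → Fin (n G) → EdgeSet G
star G v = tabulate (λ e → incident G e v)

deg : (G : Graph) → EdgeSet G → Fin (n G) → ℕ
deg G S v = ∣ S ∩ star G v ∣

Cubic : Graph → Set
Cubic G = ∀ v → deg G ⊤ v ≡ 3

OneFactor : (G : Graph) → EdgeSet G → Set
OneFactor G M = ∀ v → deg G M v ≡ 1

-- a cycle: an edge set all of whose vertices have even degree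
IsCycle : (G : Graph) → EdgeSet G → Set
IsCycle G C = ∀ v → 2 ∣ deg G C v

data Conn (G : Graph) (C : EdgeSet G) : Fin (m G) → Fin (m G) → Set where
  here : ∀ {e} → e ∈ C → Conn G C e e
  step : ∀ {e f g} → Conn G C e f → g ∈ C → (v : Fin (n G)) →
         incident G f v ≡ true → incident G g v ≡ true → Conn G C e g

-- an even cycle: every circuit (= connected component) has an even
-- number of edges
IsEvenCycle : (G : Graph) → EdgeSet G → Set
IsEvenCycle G C = IsCycle G C ×
  (∀ e → e ∈ C → ∃[ D ] ((∀ f → (f ∈ D ⇔ Conn G C e f)) × 2 ∣ ∣ D ∣))

IsCycleCover : (G : Graph) → EdgeSet G → List (EdgeSet G) → Set
IsCycleCover G H Cs =
  All (λ C → IsCycle G C × C ⊆ H) Cs × (∀ e → e ∈ H → Any (λ C → e ∈ C) Cs)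

IsLCycleCover : (G : Graph) → ℕ → EdgeSet G → List (EdgeSet G) → Set
IsLCycleCover G l H Cs = IsCycleCover G H Cs × length Cs ≤ l

coverLength : (G : Graph) → List (EdgeSet G) → ℕ
coverLength G Cs = sum (map ∣_∣ Cs)

IsEvenCover : (G : Graph) → List (EdgeSet G) → Set
IsEvenCover G Cs = All (IsEvenCycle G) Cs

pairInt : (G : Graph) → EdgeSet G → EdgeSet G → EdgeSet G → EdgeSet G
pairInt G M₁ M₂ M₃ = (M₁ ∩ M₂) ∪ ((M₁ ∩ M₃) ∪ (M₂ ∩ M₃))

uncovered : (G : Graph) → EdgeSet G → EdgeSet G → EdgeSet G → EdgeSet G
uncovered G M₁ M₂ M₃ = ∁ (M₁ ∪ (M₂ ∪ M₃))

IsKCore : (G : Graph) → ℕ → EdgeSet G → Set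
IsKCore G k H = ∃[ M₁ ] ∃[ M₂ ] ∃[ M₃ ]
  (OneFactor G M₁ × OneFactor G M₂ × OneFactor G M₃ ×
   M₁ ≢ M₂ × M₁ ≢ M₃ × M₂ ≢ M₃ ×
   ∣ uncovered G M₁ M₂ M₃ ∣ ≡ k ×
   H ≡ pairInt G M₁ M₂ M₃ ∪ uncovered G M₁ M₂ M₃)

-- The symmetric difference of two 1-factors is an even cycle: at every vertex a component of
-- it meets both 1-factors equally often, so by the handshake lemma each component has as many
-- edges of one factor as of the other.  An edge outside the core lies in exactly one Mᵢ, hence
-- in exactly two of the three symmetric differences, so any two of them together with 𝒞_c cover
-- G.  Every edge of M₁ ∪ M₂ ∪ M₃ (there are |E(G)| − k of them) lies in at most two of the
-- symmetric differences, so their sizes sum to at most 2(|E(G)| − k) and the smallest two sum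
-- to at most 4/3 (|E(G)| − k).
module Submission where

open import Defs
open import Data.Bool using (Bool; true; false; _∧_; _∨_; _xor_; not)
open import Data.Bool.Properties using (xor-comm) renaming (_≟_ to _≟ᵇ_)
open import Data.Fin using (Fin; zero; suc; _≟_)
open import Data.Fin.Properties using (any?)
open import Data.Fin.Subset using (Subset; _∈_; _∉_; _⊆_; _∩_; _∪_; ∣_∣; ⊤; ⊥; ⁅_⁆; Nonempty)
open import Data.Fin.Subset.Properties
  using (_∈?_; nonempty?; drop-∷-⊆; ⊆⊤; x∈⁅x⁆; x∈⁅y⁆⇒x≡y; x∈p∩q⁺; x∈p∩q⁻; x∈p∪q⁺; x∈p∪q⁻;
         p⊆p∪q; ∩-assoc; ∩-comm; x∈p∧x≢y⇒x∈p-y;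
         ∣p∣≤n; ∣⊥∣≡0; ∣∁p∣≡n∸∣p∣; p⊆q⇒∣p∣≤∣q∣; p⊂q⇒∣p∣<∣q∣; x∈p⇒∣p-x∣<∣p∣)
open import Data.List using (List; _∷_)
open import Data.List.Relation.Unary.All as All using (_∷_)
open import Data.List.Relation.Unary.Any using (Any; here; there)
open import Data.Nat using (ℕ; zero; suc; _+_; _*_; _∸_; _≤_; _<_; z≤n; s≤s)
open import Data.Nat.Divisibility using (_∣_; divides)
open import Data.Nat.Properties hiding (_≟_)
open import Algebra.Properties.Semiring.Sum +-*-semiring
  using (sum; sum-syntax; sum-cong-≗; sum-replicate-zero; ∑-distrib-+; ∑-comm; *-distribˡ-sum)
open import Data.Nat.Solver using (module +-*-Solver)
open +-*-Solver using (solve; _:+_; _:*_; _:=_; con)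
open import Data.Product using (_×_; _,_; proj₁; proj₂; ∃-syntax)
open import Data.Sum as Sum using (_⊎_; inj₁; inj₂)
open import Data.Vec using (_∷_; []; tabulate; lookup; zipWith; here)
open import Data.Vec.Properties
  using ([]=⇒lookup; lookup⇒[]=; lookup-zipWith; lookup-map; lookup∘tabulate; zipWith-comm)
open import Function using (_∘_; _⇔_; mk⇔; Equivalence)
open import Relation.Binary using (Rel)
import Relation.Binary.Definitions as B
open import Relation.Binary.Construct.Closure.ReflexiveTransitive using (Star; ε; _◅_; _◅◅_)
open import Relation.Binary.PropositionalEquality
open import Relation.Nullary using (Dec; does; yes; no; contradiction)
open import Relation.Nullary.Decidable using (map′; dec-true; _×-dec_; ¬?)
open import Relation.Unary using (Pred; Decidable)


2∣m+m : ∀ m → 2 ∣ m + m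
2∣m+m m = divides m (solve 1 (λ m → m :+ m := m :* con 2) refl m)

≤1-ext : ∀ {x y} → x ≤ 1 → y ≤ 1 → (0 < x → 0 < y) → (0 < y → 0 < x) → x ≡ y
≤1-ext {zero}  {zero}  _ _ _ _ = refl
≤1-ext {suc _} {suc _} (s≤s z≤n) (s≤s z≤n) _ _ = refl
≤1-ext {zero}  {suc _} _ _ _ y⇒x = contradiction (y⇒x (s≤s z≤n)) λ ()
≤1-ext {suc _} {zero}  _ _ x⇒y _ = contradiction (x⇒y (s≤s z≤n)) λ ()

≤-average : ∀ a b c → 3 * a ≤ a + b + c ⊎ 3 * b ≤ a + b + c ⊎ 3 * c ≤ a + b + c
≤-average a b c with 3 * a ≤? a + b + c | 3 * b ≤? a + b + c | 3 * c ≤? a + b + c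
... | yes 3a≤ | _      | _      = inj₁ 3a≤
... | no _    | yes 3b≤ | _      = inj₂ (inj₁ 3b≤)
... | no _    | no _   | yes 3c≤ = inj₂ (inj₂ 3c≤)
... | no 3a≰  | no 3b≰ | no 3c≰ = contradiction 3s<3s (<-irrefl refl)
  where
  s = a + b + c
  3s<3s : 3 * s < 3 * s
  3s<3s = subst₂ _<_
    (solve 3 (λ a b c → (a :+ b :+ c) :+ (a :+ b :+ c) :+ (a :+ b :+ c) := con 3 :* (a :+ b :+ c)) refl a b c)
    (solve 3 (λ a b c → con 3 :* a :+ con 3 :* b :+ con 3 :* c := con 3 :* (a :+ b :+ c)) refl a b c)
    (+-mono-< (+-mono-< (≰⇒> 3a≰) (≰⇒> 3b≰)) (≰⇒> 3c≰))

smallest-pair≤ : ∀ x y z s → x + y + z ≤ 2 * s →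
                 3 * (x + y) ≤ 4 * s ⊎ 3 * (x + z) ≤ 4 * s ⊎ 3 * (y + z) ≤ 4 * s
smallest-pair≤ x y z s x+y+z≤2s =
  Sum.map widen (Sum.map widen widen) (≤-average (x + y) (x + z) (y + z))
  where
  widen : ∀ {a} → a ≤ (x + y) + (x + z) + (y + z) → a ≤ 4 * s
  widen {a} a≤ = begin
    a                           ≤⟨ a≤ ⟩
    (x + y) + (x + z) + (y + z) ≡⟨ solve 3 (λ x y z → (x :+ y) :+ (x :+ z) :+ (y :+ z)
                                                   := con 2 :* (x :+ y :+ z)) refl x y z ⟩
    2 * (x + y + z)             ≤⟨ *-monoʳ-≤ 2 x+y+z≤2s ⟩
    2 * (2 * s)                 ≡⟨ sym (*-assoc 2 2 s) ⟩
    4 * s                       ∎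
    where open ≤-Reasoning


𝟙 : Bool → ℕ
𝟙 true  = 1
𝟙 false = 0

∑-mono-≤ : ∀ {n} {f g : Fin n → ℕ} → (∀ i → f i ≤ g i) → ∑[ i < n ] f i ≤ ∑[ i < n ] g i
∑-mono-≤ {zero}  _   = z≤n
∑-mono-≤ {suc n} f≤g = +-mono-≤ (f≤g zero) (∑-mono-≤ (f≤g ∘ suc))

∑-𝟙-≟ : ∀ {n} (i : Fin n) → ∑[ j < n ] 𝟙 (does (i ≟ j)) ≡ 1
∑-𝟙-≟ {suc n} zero    = cong suc (sum-replicate-zero n)
∑-𝟙-≟ {suc n} (suc i) = ∑-𝟙-≟ i

∣p∣≡∑𝟙 : ∀ {n} (p : Subset n) → ∣ p ∣ ≡ ∑[ i < n ] 𝟙 (lookup p i)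
∣p∣≡∑𝟙 []          = refl
∣p∣≡∑𝟙 (true ∷ p)  = cong suc (∣p∣≡∑𝟙 p)
∣p∣≡∑𝟙 (false ∷ p) = ∣p∣≡∑𝟙 p

∣zipWith∣ : ∀ {n} (f : Bool → Bool → Bool) (p q : Subset n) →
            ∣ zipWith f p q ∣ ≡ ∑[ i < n ] 𝟙 (f (lookup p i) (lookup q i))
∣zipWith∣ f p q = trans (∣p∣≡∑𝟙 (zipWith f p q)) (sum-cong-≗ (λ i → cong 𝟙 (lookup-zipWith f i p q)))


0<∣p∣⇒Nonempty : ∀ {n} (p : Subset n) → 0 < ∣ p ∣ → Nonempty p
0<∣p∣⇒Nonempty {n} p 0<∣p∣ with nonempty? p
... | yes ne = ne
... | no ¬ne = contradiction (≤-trans (p⊆q⇒∣p∣≤∣q∣ p⊆⊥) (≤-reflexive (∣⊥∣≡0 n))) (<⇒≱ 0<∣p∣)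
  where
  p⊆⊥ : p ⊆ ⊥
  p⊆⊥ x∈p = contradiction (_ , x∈p) ¬ne

x∈p⇒0<∣p∣ : ∀ {n} {x : Fin n} {p} → x ∈ p → 0 < ∣ p ∣
x∈p⇒0<∣p∣ x∈p = ≤-trans (s≤s z≤n) (x∈p⇒∣p-x∣<∣p∣ x∈p)

x∈p∧y∈p∧x≢y⇒1<∣p∣ : ∀ {n} {x y : Fin n} {p} → x ∈ p → y ∈ p → x ≢ y → 1 < ∣ p ∣
x∈p∧y∈p∧x≢y⇒1<∣p∣ x∈p y∈p x≢y =
  ≤-trans (s≤s (x∈p⇒0<∣p∣ (x∈p∧x≢y⇒x∈p-y y∈p (x≢y ∘ sym)))) (x∈p⇒∣p-x∣<∣p∣ x∈p)

lookup-∉ : ∀ {n} {x : Fin n} {p} → x ∉ p → lookup p x ≡ false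
lookup-∉ {x = x} {p} x∉p with lookup p x in eq
... | false = refl
... | true  = contradiction (lookup⇒[]= x p eq) x∉p

select : ∀ {n ℓ} {P : Pred (Fin n) ℓ} → Decidable P → Subset n
select P? = tabulate (does ∘ P?)

∈-select⇔ : ∀ {n ℓ} {P : Pred (Fin n) ℓ} (P? : Decidable P) {x} → x ∈ select P? ⇔ P x
∈-select⇔ P? {x} = mk⇔ to (λ px → lookup⇒[]= x _ (trans (lookup∘tabulate _ x) (dec-true (P? x) px)))
  where
  to : x ∈ select P? → _
  to x∈ with P? x | trans (sym (lookup∘tabulate (does ∘ P?) x)) ([]=⇒lookup x∈)
  ... | yes px | _ = px

p∩q∩r≡p∩r∩q : ∀ {n} (p q r : Subset n) → (p ∩ q) ∩ r ≡ (p ∩ r) ∩ q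
p∩q∩r≡p∩r∩q p q r = trans (∩-assoc p q r) (trans (cong (p ∩_) (∩-comm q r)) (sym (∩-assoc p r q)))

infixr 7 _⊕_

_⊕_ : ∀ {n} → Subset n → Subset n → Subset n
p ⊕ q = zipWith _xor_ p q

⊕-comm : ∀ {n} (p q : Subset n) → p ⊕ q ≡ q ⊕ p
⊕-comm = zipWith-comm xor-comm

x∈p⊕q∧x∈p⇒x∉q : ∀ {n} {x : Fin n} {p q} → x ∈ p ⊕ q → x ∈ p → x ∉ q
x∈p⊕q∧x∈p⇒x∉q {x = x} {p} {q} x∈p⊕q x∈p x∈q with
  trans (sym ([]=⇒lookup x∈p⊕q))
        (trans (lookup-zipWith _xor_ x p q) (cong₂ _xor_ ([]=⇒lookup x∈p) ([]=⇒lookup x∈q)))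
... | ()

x∉p∧x∈q⇒x∈p⊕q : ∀ {n} {x : Fin n} {p q} → x ∉ p → x ∈ q → x ∈ p ⊕ q
x∉p∧x∈q⇒x∈p⊕q {x = x} {p} {q} x∉p x∈q = lookup⇒[]= x (p ⊕ q)
  (trans (lookup-zipWith _xor_ x p q) (cong₂ _xor_ (lookup-∉ x∉p) ([]=⇒lookup x∈q)))

∣p∣≡∣p∩q∣+∣p∩r∣ : ∀ {n} {p q r : Subset n} → p ⊆ q ⊕ r → ∣ p ∣ ≡ ∣ p ∩ q ∣ + ∣ p ∩ r ∣
∣p∣≡∣p∩q∣+∣p∩r∣ {p = []}        {[]}        {[]}        _     = refl
∣p∣≡∣p∩q∣+∣p∩r∣ {p = false ∷ _} {_ ∷ _}     {_ ∷ _}     p⊆q⊕r = ∣p∣≡∣p∩q∣+∣p∩r∣ (drop-∷-⊆ p⊆q⊕r)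
∣p∣≡∣p∩q∣+∣p∩r∣ {p = true ∷ _}  {true ∷ _}  {false ∷ _} p⊆q⊕r = cong suc (∣p∣≡∣p∩q∣+∣p∩r∣ (drop-∷-⊆ p⊆q⊕r))
∣p∣≡∣p∩q∣+∣p∩r∣ {p = true ∷ _}  {false ∷ _} {true ∷ _}  p⊆q⊕r =
  trans (cong suc (∣p∣≡∣p∩q∣+∣p∩r∣ (drop-∷-⊆ p⊆q⊕r))) (sym (+-suc _ _))
∣p∣≡∣p∩q∣+∣p∩r∣ {p = true ∷ _}  {true ∷ _}  {true ∷ _}  p⊆q⊕r = contradiction (p⊆q⊕r here) λ ()
∣p∣≡∣p∩q∣+∣p∩r∣ {p = true ∷ _}  {false ∷ _} {false ∷ _} p⊆q⊕r = contradiction (p⊆q⊕r here) λ ()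

xor-triangle : ∀ a b c → 𝟙 (a xor b) + 𝟙 (a xor c) + 𝟙 (b xor c) ≤ 2 * 𝟙 (a ∨ (b ∨ c))
xor-triangle true  true  true  = z≤n
xor-triangle true  true  false = ≤-refl
xor-triangle true  false true  = ≤-refl
xor-triangle true  false false = ≤-refl
xor-triangle false true  true  = ≤-refl
xor-triangle false true  false = ≤-refl
xor-triangle false false true  = ≤-refl
xor-triangle false false false = z≤n

∣p⊕q∣+∣p⊕r∣+∣q⊕r∣≤2*∣p∪q∪r∣ : ∀ {n} (p q r : Subset n) →
                             ∣ p ⊕ q ∣ + ∣ p ⊕ r ∣ + ∣ q ⊕ r ∣ ≤ 2 * ∣ p ∪ (q ∪ r) ∣
∣p⊕q∣+∣p⊕r∣+∣q⊕r∣≤2*∣p∪q∪r∣ {n} p q r = begin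
  ∣ p ⊕ q ∣ + ∣ p ⊕ r ∣ + ∣ q ⊕ r ∣
    ≡⟨ cong₂ _+_ (cong₂ _+_ (∣zipWith∣ _xor_ p q) (∣zipWith∣ _xor_ p r)) (∣zipWith∣ _xor_ q r) ⟩
  sum pq + sum pr + sum qr
    ≡⟨ sym (trans (∑-distrib-+ (λ i → pq i + pr i) qr) (cong (_+ sum qr) (∑-distrib-+ pq pr))) ⟩
  ∑[ i < n ] (pq i + pr i + qr i)
    ≤⟨ ∑-mono-≤ (λ i → xor-triangle (lookup p i) (lookup q i) (lookup r i)) ⟩
  ∑[ i < n ] (2 * 𝟙 (lookup p i ∨ (lookup q i ∨ lookup r i)))
    ≡⟨ sym (*-distribˡ-sum {n} 2 _) ⟩
  2 * ∑[ i < n ] 𝟙 (lookup p i ∨ (lookup q i ∨ lookup r i))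
    ≡⟨ cong (2 *_) (sym ∣p∪q∪r∣) ⟩
  2 * ∣ p ∪ (q ∪ r) ∣ ∎
  where
  open ≤-Reasoning
  pq pr qr : Fin n → ℕ
  pq i = 𝟙 (lookup p i xor lookup q i)
  pr i = 𝟙 (lookup p i xor lookup r i)
  qr i = 𝟙 (lookup q i xor lookup r i)
  ∣p∪q∪r∣ : ∣ p ∪ (q ∪ r) ∣ ≡ ∑[ i < n ] 𝟙 (lookup p i ∨ (lookup q i ∨ lookup r i))
  ∣p∪q∪r∣ = trans (∣zipWith∣ _∨_ p (q ∪ r))
                  (sum-cong-≗ (λ i → cong (𝟙 ∘ (lookup p i ∨_)) (lookup-zipWith _∨_ i q r)))


-- Reachability in a decidable relation on a finite set

ClosedUnder : ∀ {n ℓ} → Rel (Fin n) ℓ → Subset n → Set ℓ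
ClosedUnder _⇝_ S = ∀ {f g} → f ∈ S → f ⇝ g → g ∈ S

Star-closed : ∀ {n ℓ} {_⇝_ : Rel (Fin n) ℓ} {S f g} →
              ClosedUnder _⇝_ S → f ∈ S → Star _⇝_ f g → g ∈ S
Star-closed closed f∈S ε           = f∈S
Star-closed closed f∈S (f⇝h ◅ h⇝*g) = Star-closed closed (closed f∈S f⇝h) h⇝*g

module _ {n ℓ} {_⇝_ : Rel (Fin n) ℓ} (_⇝?_ : B.Decidable _⇝_) where

  private
    reachedFrom? : ∀ S g → Dec (∃[ f ] (f ∈ S × f ⇝ g))
    reachedFrom? S g = any? (λ f → f ∈? S ×-dec f ⇝? g)

    successors : Subset n → Subset n
    successors S = select (reachedFrom? S)

    successor⁺ : ∀ {S f g} → f ∈ S → f ⇝ g → g ∈ successors S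
    successor⁺ {S} f∈S f⇝g = Equivalence.from (∈-select⇔ (reachedFrom? S)) (_ , f∈S , f⇝g)

    successor⁻ : ∀ {S g} → g ∈ successors S → ∃[ f ] (f ∈ S × f ⇝ g)
    successor⁻ {S} = Equivalence.to (∈-select⇔ (reachedFrom? S))

    within : Fin n → ℕ → Subset n
    within x zero    = ⁅ x ⁆
    within x (suc k) = within x k ∪ successors (within x k)

    x∈within : ∀ x k → x ∈ within x k
    x∈within x zero    = x∈⁅x⁆ x
    x∈within x (suc k) = x∈p∪q⁺ (inj₁ (x∈within x k))

    within-sound : ∀ {x g} k → g ∈ within x k → Star _⇝_ x g
    within-sound zero g∈ rewrite x∈⁅y⁆⇒x≡y _ g∈ = ε
    within-sound {x} (suc k) g∈ with x∈p∪q⁻ (within x k) _ g∈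
    ... | inj₁ g∈W = within-sound k g∈W
    ... | inj₂ g∈succ with successor⁻ g∈succ
    ...   | f , f∈W , f⇝g = within-sound k f∈W ◅◅ (f⇝g ◅ ε)

    -- Every round either adds a new element or has reached a closed set.
    within-grows : ∀ x k → ClosedUnder _⇝_ (within x k) ⊎ k < ∣ within x k ∣
    within-grows x zero = inj₂ (x∈p⇒0<∣p∣ (x∈⁅x⁆ x))
    within-grows x (suc k)
      with any? (λ g → g ∈? successors (within x k) ×-dec ¬? (g ∈? within x k))
    ... | yes (g , g∈succ , g∉W) = inj₂ (grown (within-grows x k))
      where
      W = within x k
      grown : ClosedUnder _⇝_ W ⊎ k < ∣ W ∣ → suc k < ∣ W ∪ successors W ∣
      grown (inj₁ closed) with successor⁻ g∈succ
      ... | f , f∈W , f⇝g = contradiction (closed f∈W f⇝g) g∉W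
      grown (inj₂ k<∣W∣) =
        ≤-trans (s≤s k<∣W∣) (p⊂q⇒∣p∣<∣q∣ (p⊆p∪q _ , g , x∈p∪q⁺ (inj₂ g∈succ) , g∉W))
    ... | no ∄new = inj₁ closed
      where
      W = within x k
      successors⊆W : successors W ⊆ W
      successors⊆W {g} g∈succ with g ∈? W
      ... | yes g∈W = g∈W
      ... | no g∉W  = contradiction (g , g∈succ , g∉W) ∄new
      closed : ClosedUnder _⇝_ (W ∪ successors W)
      closed f∈W′ f⇝g = x∈p∪q⁺ (inj₁ (successors⊆W (successor⁺ f∈W f⇝g)))
        where f∈W = Sum.[ (λ f∈W → f∈W) , successors⊆W ] (x∈p∪q⁻ W _ f∈W′)

    within-closed : ∀ x → ClosedUnder _⇝_ (within x n)
    within-closed x with within-grows x n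
    ... | inj₁ closed = closed
    ... | inj₂ n<∣W∣  = contradiction (∣p∣≤n (within x n)) (<⇒≱ n<∣W∣)

  Star? : B.Decidable (Star _⇝_)
  Star? x g = map′ (within-sound n) (Star-closed (within-closed x) (x∈within x n)) (g ∈? within x n)


-- Degrees and the handshake lemma

module _ (G : Graph) where

  ∈-star⇔ : ∀ {e v} → e ∈ star G v ⇔ incident G e v ≡ true
  ∈-star⇔ {e} {v} = mk⇔ (λ e∈ → trans (sym (lookup∘tabulate _ e)) ([]=⇒lookup e∈))
                        (λ e∼v → lookup⇒[]= e (star G v) (trans (lookup∘tabulate _ e) e∼v))

  deg≡∑ : ∀ S v → deg G S v ≡ ∑[ e < m G ] 𝟙 (lookup S e ∧ incident G e v)
  deg≡∑ S v = trans (∣zipWith∣ _∧_ S (star G v))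
                    (sum-cong-≗ (λ e → cong (𝟙 ∘ (lookup S e ∧_)) (lookup∘tabulate _ e)))

  ∑-𝟙-incident : ∀ e → ∑[ v < n G ] 𝟙 (incident G e v) ≡ 2
  ∑-𝟙-incident e = begin
    ∑[ v < n G ] 𝟙 (incident G e v)                                ≡⟨ sum-cong-≗ split ⟩
    ∑[ v < n G ] (𝟙 (does (x ≟ v)) + 𝟙 (does (y ≟ v)))             ≡⟨ ∑-distrib-+ {n G} _ _ ⟩
    ∑[ v < n G ] 𝟙 (does (x ≟ v)) + ∑[ v < n G ] 𝟙 (does (y ≟ v)) ≡⟨ cong₂ _+_ (∑-𝟙-≟ x) (∑-𝟙-≟ y) ⟩
    2                                                              ∎
    where
    open ≡-Reasoning
    x = proj₁ (ends G e)
    y = proj₂ (ends G e)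
    split : ∀ v → 𝟙 (incident G e v) ≡ 𝟙 (does (x ≟ v)) + 𝟙 (does (y ≟ v))
    split v with x ≟ v | y ≟ v
    ... | yes x≡v | yes y≡v = contradiction (trans x≡v (sym y≡v)) (noLoop G e)
    ... | yes _   | no _    = refl
    ... | no _    | yes _   = refl
    ... | no _    | no _    = refl

  handshake : ∀ S → ∑[ v < n G ] deg G S v ≡ 2 * ∣ S ∣
  handshake S = begin
    ∑[ v < n G ] deg G S v                                   ≡⟨ sum-cong-≗ (deg≡∑ S) ⟩
    ∑[ v < n G ] ∑[ e < m G ] 𝟙 (lookup S e ∧ incident G e v) ≡⟨ ∑-comm {n G} {m G} _ ⟩
    ∑[ e < m G ] ∑[ v < n G ] 𝟙 (lookup S e ∧ incident G e v) ≡⟨ sum-cong-≗ edge ⟩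
    ∑[ e < m G ] (2 * 𝟙 (lookup S e))                         ≡⟨ sym (*-distribˡ-sum {m G} 2 _) ⟩
    2 * ∑[ e < m G ] 𝟙 (lookup S e)                           ≡⟨ cong (2 *_) (sym (∣p∣≡∑𝟙 S)) ⟩
    2 * ∣ S ∣ ∎
    where
    open ≡-Reasoning
    edge : ∀ e → ∑[ v < n G ] 𝟙 (lookup S e ∧ incident G e v) ≡ 2 * 𝟙 (lookup S e)
    edge e with lookup S e
    ... | true  = ∑-𝟙-incident e
    ... | false = sum-replicate-zero (n G)

  deg-mono : ∀ {S T} v → S ⊆ T → deg G S v ≤ deg G T v
  deg-mono {S} v S⊆T = p⊆q⇒∣p∣≤∣q∣ λ e∈ → let e∈S , e∼v = x∈p∩q⁻ S (star G v) e∈ in x∈p∩q⁺ (S⊆T e∈S , e∼v)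

  0<deg⇒incident : ∀ {S v} → 0 < deg G S v → ∃[ e ] (e ∈ S × incident G e v ≡ true)
  0<deg⇒incident {S} {v} 0<deg with 0<∣p∣⇒Nonempty (S ∩ star G v) 0<deg
  ... | e , e∈ = let e∈S , e∈star = x∈p∩q⁻ S (star G v) e∈ in e , e∈S , Equivalence.to ∈-star⇔ e∈star

  incident⇒0<deg : ∀ {S e v} → e ∈ S → incident G e v ≡ true → 0 < deg G S v
  incident⇒0<deg e∈S e∼v = x∈p⇒0<∣p∣ (x∈p∩q⁺ (e∈S , Equivalence.from ∈-star⇔ e∼v))

  deg≤1⇒unique : ∀ {S v e f} → deg G S v ≤ 1 → e ∈ S → f ∈ S →
                 incident G e v ≡ true → incident G f v ≡ true → e ≡ f
  deg≤1⇒unique {S} {v} {e} {f} deg≤1 e∈S f∈S e∼v f∼v with e ≟ f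
  ... | yes e≡f = e≡f
  ... | no e≢f  = contradiction (x∈p∧y∈p∧x≢y⇒1<∣p∣ (x∈p∩q⁺ (e∈S , Equivalence.from ∈-star⇔ e∼v))
                                                  (x∈p∩q⁺ (f∈S , Equivalence.from ∈-star⇔ f∼v)) e≢f)
                                (≤⇒≯ deg≤1)

  deg-split : ∀ {S A B} v → S ⊆ A ⊕ B → deg G S v ≡ deg G (S ∩ A) v + deg G (S ∩ B) v
  deg-split {S} {A} {B} v S⊆A⊕B = trans
    (∣p∣≡∣p∩q∣+∣p∩r∣ (λ e∈ → S⊆A⊕B (proj₁ (x∈p∩q⁻ S (star G v) e∈))))
    (cong₂ _+_ (cong ∣_∣ (p∩q∩r≡p∩r∩q S (star G v) A)) (cong ∣_∣ (p∩q∩r≡p∩r∩q S (star G v) B)))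


-- Only g has to lie in C, mirroring the step constructor of Conn.
Adjacent : (G : Graph) → EdgeSet G → Fin (m G) → Fin (m G) → Set
Adjacent G C f g = g ∈ C × ∃[ v ] (incident G f v ≡ true × incident G g v ≡ true)

adjacent? : (G : Graph) (C : EdgeSet G) → B.Decidable (Adjacent G C)
adjacent? G C f g = g ∈? C ×-dec any? (λ v → incident G f v ≟ᵇ true ×-dec incident G g v ≟ᵇ true)

-- IsEvenCycle asks for every component as an edge set, so reachability has to be decided.
component : (G : Graph) → EdgeSet G → Fin (m G) → EdgeSet G
component G C e = select (Star? (adjacent? G C) e)

module _ (G : Graph) {C : EdgeSet G} where

  Conn⇒Star : ∀ {e g} → Conn G C e g → Star (Adjacent G C) e g
  Conn⇒Star (here _)                 = ε
  Conn⇒Star (step c g∈C v f∼v g∼v) = Conn⇒Star c ◅◅ ((g∈C , v , f∼v , g∼v) ◅ ε)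

  Conn-extend : ∀ {e f g} → Conn G C e f → Star (Adjacent G C) f g → Conn G C e g
  Conn-extend c ε                                = c
  Conn-extend c ((g∈C , v , f∼v , g∼v) ◅ rest) = Conn-extend (step c g∈C v f∼v g∼v) rest

  Conn⇒∈ : ∀ {e g} → Conn G C e g → g ∈ C
  Conn⇒∈ (here e∈C)          = e∈C
  Conn⇒∈ (step _ g∈C _ _ _) = g∈C

  ∈component⇔Conn : ∀ {e f} → e ∈ C → f ∈ component G C e ⇔ Conn G C e f
  ∈component⇔Conn {e} e∈C = mk⇔
    (λ f∈ → Conn-extend (here e∈C) (Equivalence.to (∈-select⇔ (Star? (adjacent? G C) e)) f∈))
    (λ c → Equivalence.from (∈-select⇔ (Star? (adjacent? G C) e)) (Conn⇒Star c))

  component⊆ : ∀ {e} → e ∈ C → component G C e ⊆ C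
  component⊆ e∈C f∈ = Conn⇒∈ (Equivalence.to (∈component⇔Conn e∈C) f∈)

  component-closed : ∀ e → ClosedUnder (Adjacent G C) (component G C e)
  component-closed e f∈ f∼g = Equivalence.from (∈-select⇔ (Star? (adjacent? G C) e))
    (Equivalence.to (∈-select⇔ (Star? (adjacent? G C) e)) f∈ ◅◅ (f∼g ◅ ε))


-- The symmetric difference of two 1-factors is an even cycle

module _ {G : Graph} where

  -- The B-edge g at v is not in A: otherwise it would be the A-edge e of D at v,
  -- which is not in B because D ⊆ A ⊕ B.
  0<deg∩-transfer : ∀ {A B D v} → OneFactor G A → OneFactor G B →
                    D ⊆ A ⊕ B → ClosedUnder (Adjacent G (A ⊕ B)) D →
                    0 < deg G (D ∩ A) v → 0 < deg G (D ∩ B) v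
  0<deg∩-transfer {A} {B} {D} {v} A-1f B-1f D⊆A⊕B closed 0<deg
    with 0<deg⇒incident G 0<deg | 0<deg⇒incident G (≤-reflexive (sym (B-1f v)))
  ... | e , e∈D∩A , e∼v | g , g∈B , g∼v = incident⇒0<deg G (x∈p∩q⁺ (g∈D , g∈B)) g∼v
    where
    e∈D = proj₁ (x∈p∩q⁻ D A e∈D∩A)
    e∈A = proj₂ (x∈p∩q⁻ D A e∈D∩A)
    g∉A : g ∉ A
    g∉A g∈A = x∈p⊕q∧x∈p⇒x∉q (D⊆A⊕B e∈D) e∈A
      (subst (_∈ B) (deg≤1⇒unique G (≤-reflexive (A-1f v)) g∈A e∈A g∼v e∼v) g∈B)
    g∈D : g ∈ D
    g∈D = closed e∈D (x∉p∧x∈q⇒x∈p⊕q g∉A g∈B , v , e∼v , g∼v)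

  deg∩≡deg∩ : ∀ {A B D} → OneFactor G A → OneFactor G B →
              D ⊆ A ⊕ B → ClosedUnder (Adjacent G (A ⊕ B)) D →
              ∀ v → deg G (D ∩ A) v ≡ deg G (D ∩ B) v
  deg∩≡deg∩ {A} {B} {D} A-1f B-1f D⊆A⊕B closed v = ≤1-ext
    (≤-trans (deg-mono G v (λ e∈ → proj₂ (x∈p∩q⁻ D A e∈))) (≤-reflexive (A-1f v)))
    (≤-trans (deg-mono G v (λ e∈ → proj₂ (x∈p∩q⁻ D B e∈))) (≤-reflexive (B-1f v)))
    (0<deg∩-transfer A-1f B-1f D⊆A⊕B closed)
    (0<deg∩-transfer B-1f A-1f (subst (D ⊆_) (⊕-comm A B) D⊆A⊕B)
                               (subst (λ X → ClosedUnder (Adjacent G X) D) (⊕-comm A B) closed))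

  closed⊆⊕⇒even : ∀ {A B D} → OneFactor G A → OneFactor G B →
                  D ⊆ A ⊕ B → ClosedUnder (Adjacent G (A ⊕ B)) D → 2 ∣ ∣ D ∣
  closed⊆⊕⇒even {A} {B} {D} A-1f B-1f D⊆A⊕B closed =
    subst (2 ∣_) (sym ∣D∣≡∣D∩A∣+∣D∩A∣) (2∣m+m ∣ D ∩ A ∣)
    where
    ∣D∩A∣≡∣D∩B∣ : ∣ D ∩ A ∣ ≡ ∣ D ∩ B ∣
    ∣D∩A∣≡∣D∩B∣ = *-cancelˡ-≡ _ _ 2 (begin
      2 * ∣ D ∩ A ∣              ≡⟨ sym (handshake G (D ∩ A)) ⟩
      ∑[ v < n G ] deg G (D ∩ A) v ≡⟨ sum-cong-≗ (deg∩≡deg∩ A-1f B-1f D⊆A⊕B closed) ⟩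
      ∑[ v < n G ] deg G (D ∩ B) v ≡⟨ handshake G (D ∩ B) ⟩
      2 * ∣ D ∩ B ∣              ∎)
      where open ≡-Reasoning
    ∣D∣≡∣D∩A∣+∣D∩A∣ : ∣ D ∣ ≡ ∣ D ∩ A ∣ + ∣ D ∩ A ∣
    ∣D∣≡∣D∩A∣+∣D∩A∣ = trans (∣p∣≡∣p∩q∣+∣p∩r∣ D⊆A⊕B) (cong (∣ D ∩ A ∣ +_) (sym ∣D∩A∣≡∣D∩B∣))

  ⊕-isCycle : ∀ {A B} → OneFactor G A → OneFactor G B → IsCycle G (A ⊕ B)
  ⊕-isCycle {A} {B} A-1f B-1f v = subst (2 ∣_) (sym deg≡) (2∣m+m (deg G ((A ⊕ B) ∩ A) v))
    where
    deg≡ : deg G (A ⊕ B) v ≡ deg G ((A ⊕ B) ∩ A) v + deg G ((A ⊕ B) ∩ A) v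
    deg≡ = trans (deg-split G {A ⊕ B} {A} {B} v (λ e∈ → e∈))
                 (cong (deg G ((A ⊕ B) ∩ A) v +_)
                       (sym (deg∩≡deg∩ {D = A ⊕ B} A-1f B-1f (λ e∈ → e∈) (λ _ (g∈ , _) → g∈) v)))

  ⊕-isEvenCycle : ∀ {A B} → OneFactor G A → OneFactor G B → IsEvenCycle G (A ⊕ B)
  ⊕-isEvenCycle {A} {B} A-1f B-1f = ⊕-isCycle {A} {B} A-1f B-1f , λ e e∈X →
    component G (A ⊕ B) e ,
    (λ f → ∈component⇔Conn G e∈X) ,
    closed⊆⊕⇒even A-1f B-1f (component⊆ G e∈X) (component-closed G e)


-- Covers from two symmetric differences

outside-core : ∀ a b c → ((a ∧ b) ∨ ((a ∧ c) ∨ (b ∧ c))) ∨ not (a ∨ (b ∨ c)) ≡ false →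
               (a xor b ≡ true ⊎ a xor c ≡ true) ×
               (a xor b ≡ true ⊎ b xor c ≡ true) ×
               (a xor c ≡ true ⊎ b xor c ≡ true)
outside-core true  false false _ = inj₁ refl , inj₁ refl , inj₁ refl
outside-core false true  false _ = inj₁ refl , inj₁ refl , inj₂ refl
outside-core false false true  _ = inj₂ refl , inj₂ refl , inj₂ refl
outside-core true  true  _     ()
outside-core true  false true  ()
outside-core false true  true  ()
outside-core false false false ()

module _ (G : Graph) where

  lookup-core : ∀ (A B C : EdgeSet G) e → let a = lookup A e; b = lookup B e; c = lookup C e in
                lookup (pairInt G A B C ∪ uncovered G A B C) e ≡
                ((a ∧ b) ∨ ((a ∧ c) ∨ (b ∧ c))) ∨ not (a ∨ (b ∨ c))
  lookup-core A B C e = trans (lookup-zipWith _∨_ e (pairInt G A B C) (uncovered G A B C)) (cong₂ _∨_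
    (trans (lookup-zipWith _∨_ e (A ∩ B) _) (cong₂ _∨_ (lookup-zipWith _∧_ e A B)
      (trans (lookup-zipWith _∨_ e (A ∩ C) (B ∩ C)) (cong₂ _∨_ (lookup-zipWith _∧_ e A C) (lookup-zipWith _∧_ e B C)))))
    (trans (lookup-map e not (A ∪ (B ∪ C))) (cong not
      (trans (lookup-zipWith _∨_ e A (B ∪ C)) (cong (lookup A e ∨_) (lookup-zipWith _∨_ e B C))))))

  ∉core⇒∈⊕ : ∀ (A B C : EdgeSet G) {e} → e ∉ pairInt G A B C ∪ uncovered G A B C →
             (e ∈ A ⊕ B ⊎ e ∈ A ⊕ C) × (e ∈ A ⊕ B ⊎ e ∈ B ⊕ C) × (e ∈ A ⊕ C ⊎ e ∈ B ⊕ C)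
  ∉core⇒∈⊕ A B C {e} e∉core with outside-core (lookup A e) (lookup B e) (lookup C e)
                                               (trans (sym (lookup-core A B C e)) (lookup-∉ e∉core))
  ... | AB⊎AC , AB⊎BC , AC⊎BC =
    Sum.map (∈⊕ A B) (∈⊕ A C) AB⊎AC , Sum.map (∈⊕ A B) (∈⊕ B C) AB⊎BC , Sum.map (∈⊕ A C) (∈⊕ B C) AC⊎BC
    where
    ∈⊕ : ∀ P Q → lookup P e xor lookup Q e ≡ true → e ∈ P ⊕ Q
    ∈⊕ P Q eq = lookup⇒[]= e (P ⊕ Q) (trans (lookup-zipWith _xor_ e P Q) eq)

  ∣A⊕B∣+∣A⊕C∣+∣B⊕C∣≤2[m∸k] : ∀ {k} (A B C : EdgeSet G) → ∣ uncovered G A B C ∣ ≡ k →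
                               ∣ A ⊕ B ∣ + ∣ A ⊕ C ∣ + ∣ B ⊕ C ∣ ≤ 2 * (m G ∸ k)
  ∣A⊕B∣+∣A⊕C∣+∣B⊕C∣≤2[m∸k] {k} A B C ∣U∣≡k =
    subst (λ u → ∣ A ⊕ B ∣ + ∣ A ⊕ C ∣ + ∣ B ⊕ C ∣ ≤ 2 * u) ∣A∪B∪C∣≡m∸k (∣p⊕q∣+∣p⊕r∣+∣q⊕r∣≤2*∣p∪q∪r∣ A B C)
    where
    ∣A∪B∪C∣≡m∸k : ∣ A ∪ (B ∪ C) ∣ ≡ m G ∸ k
    ∣A∪B∪C∣≡m∸k = begin
      ∣ A ∪ (B ∪ C) ∣                 ≡⟨ sym (m∸[m∸n]≡n (∣p∣≤n (A ∪ (B ∪ C)))) ⟩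
      m G ∸ (m G ∸ ∣ A ∪ (B ∪ C) ∣) ≡⟨ cong (m G ∸_) (sym (∣∁p∣≡n∸∣p∣ (A ∪ (B ∪ C)))) ⟩
      m G ∸ ∣ uncovered G A B C ∣    ≡⟨ cong (m G ∸_) ∣U∣≡k ⟩
      m G ∸ k                        ∎
      where open ≡-Reasoning

  extend-cover : ∀ {l H Cc P Q} → IsCycle G P → IsCycle G Q → (∀ e → e ∉ H → e ∈ P ⊎ e ∈ Q) →
                 IsLCycleCover G l H Cc → IsLCycleCover G (l + 2) ⊤ (P ∷ Q ∷ Cc)
  extend-cover {l} {H} {Cc} {P} {Q} P-cycle Q-cycle P∪Q⊇∁H ((Cc-cycles , Cc-covers) , length≤l) =
    (spanning P-cycle ∷ spanning Q-cycle ∷ All.map (spanning ∘ proj₁) Cc-cycles , covers) ,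
    ≤-trans (s≤s (s≤s length≤l)) (≤-reflexive (+-comm 2 l))
    where
    spanning : ∀ {C} → IsCycle G C → IsCycle G C × C ⊆ ⊤
    spanning C-cycle = C-cycle , ⊆⊤
    covers : ∀ e → e ∈ ⊤ → Any (e ∈_) (P ∷ Q ∷ Cc)
    covers e _ with e ∈? H
    ... | yes e∈H = there (there (Cc-covers e e∈H))
    ... | no e∉H with P∪Q⊇∁H e e∉H
    ...   | inj₁ e∈P = here e∈P
    ...   | inj₂ e∈Q = there (here e∈Q)

  cover-from-pair : ∀ k {l t H Cc} (P Q : EdgeSet G) → IsEvenCycle G P → IsEvenCycle G Q →
                    (∀ e → e ∉ H → e ∈ P ⊎ e ∈ Q) → 3 * (∣ P ∣ + ∣ Q ∣) ≤ 4 * (m G ∸ k) →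
                    IsLCycleCover G l H Cc → coverLength G Cc ≡ t →
                    ∃[ C ] (IsLCycleCover G (l + 2) ⊤ C ×
                            3 * coverLength G C ≤ 4 * (m G ∸ k) + 3 * t ×
                            (IsEvenCover G Cc → IsEvenCover G C))
  cover-from-pair k {Cc = Cc} P Q P-even Q-even P∪Q⊇∁H bound Cc-cover refl =
    P ∷ Q ∷ Cc ,
    extend-cover (proj₁ P-even) (proj₁ Q-even) P∪Q⊇∁H Cc-cover ,
    length-bound ,
    (λ Cc-even → P-even ∷ Q-even ∷ Cc-even)
    where
    T = coverLength G Cc
    length-bound : 3 * (∣ P ∣ + (∣ Q ∣ + T)) ≤ 4 * (m G ∸ k) + 3 * T
    length-bound = subst (_≤ 4 * (m G ∸ k) + 3 * T)
      (solve 3 (λ p q t → con 3 :* (p :+ q) :+ con 3 :* t := con 3 :* (p :+ (q :+ t))) refl ∣ P ∣ ∣ Q ∣ T)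
      (+-monoˡ-≤ (3 * T) bound)

mainTheorem9 : (k l t : ℕ) (G : Graph) → Cubic G →
    (H : EdgeSet G) → IsKCore G k H →
    (Cc : List (EdgeSet G)) → IsLCycleCover G l H Cc → coverLength G Cc ≡ t →
    ∃[ C ] (IsLCycleCover G (l + 2) ⊤ C ×
            3 * coverLength G C ≤ 4 * (m G ∸ k) + 3 * t ×
            (IsEvenCover G Cc → IsEvenCover G C))
mainTheorem9 k l t G _ H (M₁ , M₂ , M₃ , M₁-1f , M₂-1f , M₃-1f , _ , _ , _ , ∣U∣≡k , refl) Cc Cc-cover ∣Cc∣≡t
  with smallest-pair≤ (∣ M₁ ⊕ M₂ ∣) (∣ M₁ ⊕ M₃ ∣) (∣ M₂ ⊕ M₃ ∣) (m G ∸ k)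
                      (∣A⊕B∣+∣A⊕C∣+∣B⊕C∣≤2[m∸k] G M₁ M₂ M₃ ∣U∣≡k)
... | inj₁ bound =
  cover-from-pair G k (M₁ ⊕ M₂) (M₁ ⊕ M₃) (⊕-isEvenCycle M₁-1f M₂-1f) (⊕-isEvenCycle M₁-1f M₃-1f)
    (λ _ → proj₁ ∘ ∉core⇒∈⊕ G M₁ M₂ M₃) bound Cc-cover ∣Cc∣≡t
... | inj₂ (inj₁ bound) =
  cover-from-pair G k (M₁ ⊕ M₂) (M₂ ⊕ M₃) (⊕-isEvenCycle M₁-1f M₂-1f) (⊕-isEvenCycle M₂-1f M₃-1f)
    (λ _ → proj₁ ∘ proj₂ ∘ ∉core⇒∈⊕ G M₁ M₂ M₃) bound Cc-cover ∣Cc∣≡t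
... | inj₂ (inj₂ bound) =
  cover-from-pair G k (M₁ ⊕ M₃) (M₂ ⊕ M₃) (⊕-isEvenCycle M₁-1f M₃-1f) (⊕-isEvenCycle M₂-1f M₃-1f)
    (λ _ → proj₂ ∘ proj₂ ∘ ∉core⇒∈⊕ G M₁ M₂ M₃) bound Cc-cover ∣Cc∣≡t
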